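{- Let $G$ be a 2-tree of order at least $4$. Then there is a subgraph $H\in\mathcal{H}^{(2)}(G)\cup\mathcal{T}^{(2)}(G)$ that is neither a hat nor a double hat of $G$.
   Context: A graph $G$ is a 2-tree if it can be built from $K_3$ by repeatedly adding a new vertex adjacent to exactly the two ends of an existing edge. For a clique $V$ of order $2$ of $G$ and a vertex $u$ adjacent to both vertices of $V$, the branch $B(V,u)$ is the subgraph induced by $V\cup V(G_u)$ where $G_u$ is the component of $G-V$ containing $u$. An ear is a branch $B(\{v_1,v_2\},u_0)$ with vertex set $\{v_1,v_2,u_0\}$ and $N_G(u_0)=\{v_1,v_2\}$. A hat is a branch $B(\{v_1,v_2\},u_0)$ with vertex set $\{v_1,v_2,u_0,u_1,u_2\}$ such that $N_G(u_0)=\{v_1,v_2,u_1,u_2\}$, $N_G(u_1)=\{v_1,u_0\}$, $N_G(u_2)=\{v_2,u_0\}$. A double hat is a branch $B(\{v_1,v_2\},u_0)$ with vertex set $\{v_1,v_2,u_0,\dots,u_6\}$ such that $N_G(u_0)=\{v_1,v_2,u_1,u_2,u_4,u_5\}$, $N_G(u_1)=\{v_1,u_0,u_3,u_4\}$, $N_G(u_2)=\{v_2,u_0,u_5,u_6\}$, $N_G(u_3)=\{v_1,u_1\}$, $N_G(u_4)=\{u_0,u_1\}$, $N_G(u_5)=\{u_0,u_2\}$, $N_G(u_6)=\{v_2,u_2\}$. For non-negative integers $a,b,c$ with $1\le a+b+c\le2$ and a triangle $\{v_1,v_2,u_0\}$ of $G$, the branch $B(\{v_1,v_2\},u_0)$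 belongs to $\mathcal{H}^{(2)}_{a,b,c}(G)$ if: $|N_G(u_0)\cap N_G(v_1)|\le2$, and if equality holds then $N_G(u_0)\cap N_G(v_1)=\{v_2,u_1\}$ for a vertex $u_1$ such that $B(\{v_1,u_0\},u_1)$ is an ear, a hat or a double hat; $|N_G(u_0)\cap N_G(v_2)|\le2$, and if equality holds then $N_G(u_0)\cap N_G(v_2)=\{v_1,u_2\}$ for a vertex $u_2$ such that $B(\{v_2,u_0\},u_2)$ is an ear, a hat or a double hat; and the collection of those of $B(\{v_1,u_0\},u_1)$, $B(\{v_2,u_0\},u_2)$ that exist consists of exactly $a$ ears, $b$ hats and $c$ double hats. Let $\mathcal{H}^{(2)}(G)=\bigcup_{1\le a+b+c\le2}\mathcal{H}^{(2)}_{a,b,c}(G)$. For non-negative integers $a,b,c$ with $a+b+c=2$ and two distinct triangles $\{v_1,v_2,u_0\}$, $\{v_1,v_2,w_0\}$, the subgraph induced by $V(B(\{v_1,v_2\},u_0))\cup V(B(\{v_1,v_2\},w_0))$ belongs to $\mathcal{T}^{(2)}_{a,b,c}(G)$ if each of these two branches is an ear, a hat or a double hat, and together they consist of $a$ ears, $b$ hats and $c$ double hats. Let $\mathcal{T}^{(2)}(G)=\bigcup_{a+b+c=2}\mathcal{T}^{(2)}_{a,b,c}(G)$. -}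

module Defs where

open import Data.Nat using (ℕ; suc; _+_; _≤_)
open import Data.Fin using (Fin; punchIn; _≟_)
open import Data.Bool using (Bool; true; false; not; _∨_)
open import Data.List using (List; []; _∷_)
open import Data.List.Membership.Propositional using (_∈_)
open import Data.List.Relation.Unary.Unique.Propositional using (Unique)
open import Data.Maybe using (Maybe; just; nothing)
open import Data.Product using (Σ; ∃; ∃-syntax; _×_; _,_)
open import Data.Sum using (_⊎_)
open import Relation.Nullary using (¬_)
open import Relation.Nullary.Decidable using (⌊_⌋)
open import Relation.Binary.PropositionalEquality using (_≡_; _≢_)

Graph : ℕ → Set
Graph n = Fin n → Fin n → Bool

-- 2-trees: start with K3, repeatedly add a new vertex p adjacent to exactly
-- the two ends a, b of an existing edge.  The new vertex may receive any
-- label p; the old vertices are relabelled by punchIn p.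
data TwoTree : (n : ℕ) → Graph n → Set where
  base : (G : Graph 3) → (∀ i j → G i j ≡ not ⌊ i ≟ j ⌋) → TwoTree 3 G
  step : ∀ {n} (G : Graph n) (G' : Graph (suc n)) (p : Fin (suc n)) (a b : Fin n) →
         TwoTree n G → G a b ≡ true →
         (∀ i j → G' (punchIn p i) (punchIn p j) ≡ G i j) →
         (∀ j → G' p (punchIn p j) ≡ (⌊ j ≟ a ⌋ ∨ ⌊ j ≟ b ⌋)) →
         (∀ j → G' (punchIn p j) p ≡ (⌊ j ≟ a ⌋ ∨ ⌊ j ≟ b ⌋)) →
         G' p p ≡ false →
         TwoTree (suc n) G'

VSet : ℕ → Set₁
VSet n = Fin n → Set

_≐_ : ∀ {n} → VSet n → VSet n → Set
S ≐ T = ∀ x → (S x → T x) × (T x → S x)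

SetOf : ∀ {n} → List (Fin n) → VSet n
SetOf xs w = w ∈ xs

_∩_ : ∀ {n} → VSet n → VSet n → VSet n
(S ∩ T) x = S x × T x

_∪_ : ∀ {n} → VSet n → VSet n → VSet n
(S ∪ T) x = S x ⊎ T x

data Kind : Set where
  ear hat dhat : Kind

count : List Kind → ℕ × ℕ × ℕ
count [] = 0 , 0 , 0
count (ear ∷ ks) with count ks
... | a , b , c = suc a , b , c
count (hat ∷ ks) with count ks
... | a , b , c = a , suc b , c
count (dhat ∷ ks) with count ks
... | a , b , c = a , b , suc c

present : List (Maybe Kind) → List Kind
present [] = []
present (nothing ∷ ks) = present ks
present (just k ∷ ks) = k ∷ present ks

module _ {n : ℕ} (G : Graph n) where

  Adj : Fin n → Fin n → Set
  Adj x y = G x y ≡ true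

  N : Fin n → VSet n
  N x y = Adj x y

  Triangle : Fin n → Fin n → Fin n → Set
  Triangle x y z = Adj x y × Adj y z × Adj x z

  data Path (avoid : VSet n) (u : Fin n) : Fin n → Set where
    here : ¬ avoid u → Path avoid u u
    next : ∀ {v w} → Path avoid u v → Adj v w → ¬ avoid w → Path avoid u w

  -- vertex set of the branch B({v1,v2},u): V ∪ V(G_u), G_u the component
  -- of G - V containing u
  BranchSet : Fin n → Fin n → Fin n → VSet n
  BranchSet v1 v2 u w = w ≡ v1 ⊎ w ≡ v2 ⊎ Path (SetOf (v1 ∷ v2 ∷ [])) u w

  IsBranch : Fin n → Fin n → Fin n → Set
  IsBranch v1 v2 u = v1 ≢ v2 × Adj v1 v2 × Adj u v1 × Adj u v2

  Ear : Fin n → Fin n → Fin n → Set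
  Ear v1 v2 u0 =
    IsBranch v1 v2 u0 ×
    Unique (v1 ∷ v2 ∷ u0 ∷ []) ×
    BranchSet v1 v2 u0 ≐ SetOf (v1 ∷ v2 ∷ u0 ∷ []) ×
    N u0 ≐ SetOf (v1 ∷ v2 ∷ [])

  Hat : Fin n → Fin n → Fin n → Set
  Hat v1 v2 u0 =
    IsBranch v1 v2 u0 ×
    Σ (Fin n) λ u1 → Σ (Fin n) λ u2 →
      Unique (v1 ∷ v2 ∷ u0 ∷ u1 ∷ u2 ∷ []) ×
      BranchSet v1 v2 u0 ≐ SetOf (v1 ∷ v2 ∷ u0 ∷ u1 ∷ u2 ∷ []) ×
      N u0 ≐ SetOf (v1 ∷ v2 ∷ u1 ∷ u2 ∷ []) ×
      N u1 ≐ SetOf (v1 ∷ u0 ∷ []) ×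
      N u2 ≐ SetOf (v2 ∷ u0 ∷ [])

  DoubleHat : Fin n → Fin n → Fin n → Set
  DoubleHat v1 v2 u0 =
    IsBranch v1 v2 u0 ×
    Σ (Fin n) λ u1 → Σ (Fin n) λ u2 → Σ (Fin n) λ u3 → Σ (Fin n) λ u4 →
    Σ (Fin n) λ u5 → Σ (Fin n) λ u6 →
      Unique (v1 ∷ v2 ∷ u0 ∷ u1 ∷ u2 ∷ u3 ∷ u4 ∷ u5 ∷ u6 ∷ []) ×
      BranchSet v1 v2 u0 ≐ SetOf (v1 ∷ v2 ∷ u0 ∷ u1 ∷ u2 ∷ u3 ∷ u4 ∷ u5 ∷ u6 ∷ []) ×
      N u0 ≐ SetOf (v1 ∷ v2 ∷ u1 ∷ u2 ∷ u4 ∷ u5 ∷ []) ×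
      N u1 ≐ SetOf (v1 ∷ u0 ∷ u3 ∷ u4 ∷ []) ×
      N u2 ≐ SetOf (v2 ∷ u0 ∷ u5 ∷ u6 ∷ []) ×
      N u3 ≐ SetOf (v1 ∷ u1 ∷ []) ×
      N u4 ≐ SetOf (u0 ∷ u1 ∷ []) ×
      N u5 ≐ SetOf (u0 ∷ u2 ∷ []) ×
      N u6 ≐ SetOf (v2 ∷ u2 ∷ [])

  IsKind : Kind → Fin n → Fin n → Fin n → Set
  IsKind ear = Ear
  IsKind hat = Hat
  IsKind dhat = DoubleHat

  -- Condition on one side of the triangle {v, w, u0} (v = v1, w = v2 or
  -- vice versa): nothing  ↔ |N(u0) ∩ N(v)| ≤ 2 with strict inequality
  -- (so N(u0) ∩ N(v) = {w}); just k ↔ N(u0) ∩ N(v) = {w, u} for a vertex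
  -- u ≠ w such that B({v,u0},u) is a branch of kind k.
  Side : Fin n → Fin n → Fin n → Maybe Kind → Set
  Side v w u0 nothing = (N u0 ∩ N v) ≐ SetOf (w ∷ [])
  Side v w u0 (just k) =
    Σ (Fin n) λ u → u ≢ w × (N u0 ∩ N v) ≐ SetOf (w ∷ u ∷ []) × IsKind k v u0 u

  InH2abc : ℕ → ℕ → ℕ → Fin n → Fin n → Fin n → Set
  InH2abc a b c v1 v2 u0 =
    Triangle v1 v2 u0 ×
    Σ (Maybe Kind) λ k1 → Σ (Maybe Kind) λ k2 →
      Side v1 v2 u0 k1 × Side v2 v1 u0 k2 ×
      count (present (k1 ∷ k2 ∷ [])) ≡ (a , b , c)

  InH2 : VSet n → Set
  InH2 H = Σ ℕ λ a → Σ ℕ λ b → Σ ℕ λ c →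
    1 ≤ a + b + c × a + b + c ≤ 2 ×
    Σ (Fin n) λ v1 → Σ (Fin n) λ v2 → Σ (Fin n) λ u0 →
      InH2abc a b c v1 v2 u0 × H ≐ BranchSet v1 v2 u0

  InT2abc : ℕ → ℕ → ℕ → Fin n → Fin n → Fin n → Fin n → Set
  InT2abc a b c v1 v2 u0 w0 =
    Triangle v1 v2 u0 × Triangle v1 v2 w0 × u0 ≢ w0 ×
    Σ Kind λ k1 → Σ Kind λ k2 →
      IsKind k1 v1 v2 u0 × IsKind k2 v1 v2 w0 ×
      count (k1 ∷ k2 ∷ []) ≡ (a , b , c)

  InT2 : VSet n → Set
  InT2 H = Σ ℕ λ a → Σ ℕ λ b → Σ ℕ λ c →
    a + b + c ≡ 2 ×
    Σ (Fin n) λ v1 → Σ (Fin n) λ v2 → Σ (Fin n) λ u0 → Σ (Fin n) λ w0 →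
      InT2abc a b c v1 v2 u0 w0 × H ≐ (BranchSet v1 v2 u0 ∪ BranchSet v1 v2 w0)

  -- the (induced) subgraph with vertex set H is a hat / double hat of G
  IsHatOf : VSet n → Set
  IsHatOf H = Σ (Fin n) λ v1 → Σ (Fin n) λ v2 → Σ (Fin n) λ u0 →
    Hat v1 v2 u0 × H ≐ BranchSet v1 v2 u0

  IsDoubleHatOf : VSet n → Set
  IsDoubleHatOf H = Σ (Fin n) λ v1 → Σ (Fin n) λ v2 → Σ (Fin n) λ u0 →
    DoubleHat v1 v2 u0 × H ≐ BranchSet v1 v2 u0

-- In a 2-tree, distinct common neighbours of an edge are separated by it and every neighbourhood
-- is connected.  Hence the branch B({x,y},u) is {x,y,u} together with the pairwise disjoint
-- branches B({x,u},t), t ≠ y, and B({y,u},t′), t′ ≠ x.  By recursion on branches, every branch is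
-- an ear, a hat or a double hat, or contains the required H: two branches at {x,u} that are ears,
-- hats or double hats form a member of T⁽²⁾; otherwise each side of u carries at most one branch,
-- and B({x,y},u) is an ear, a hat or a double hat (both sides empty, ears or hats) or lies in H⁽²⁾.
-- Such members are told apart from hats and double hats by their orders: a member of T⁽²⁾ has
-- 2 + i₁ + i₂ vertices and one of H⁽²⁾ has 3 + i₁ + i₂, where iₖ ∈ {1,3,7} counts the vertices of
-- a branch off its base edge (iₖ = 0 for an empty side), and this is 5 or 9 only in the excluded
-- cases.  Finally, a 2-tree of order at least 4 has an edge with two common neighbours, and the
-- two branches at that edge yield H.

module Submission where

open import Defs
open import Data.Bool using (true; false; not; _∨_)
import Data.Bool as Bool
open import Data.Bool.Properties using (T-∨; T-≡)
open import Data.Empty using (⊥; ⊥-elim)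
open import Data.Fin using (Fin; zero; suc; _≟_; punchIn; punchOut)
open import Data.Fin.Properties using (any?; punchIn-punchOut; punchInᵢ≢i; punchIn-injective)
open import Data.List using (List; []; _∷_; _++_; length; filter; allFin)
open import Data.List.Properties using (length-filter; length-++; filter-notAll)
open import Data.List.Membership.Propositional using (_∈_; _∉_)
open import Data.List.Membership.Propositional.Properties
  using (∈-filter⁺; ∈-filter⁻; ∈-allFin; ∈-++⁺ˡ; ∈-++⁺ʳ; ∈-++⁻)
open import Data.List.Membership.Propositional.Properties.WithK using (unique∧set⇒bag)
open import Data.List.Relation.Binary.BagAndSetEquality using (_∼[_]_; set; ∼bag⇒↭)
open import Data.List.Relation.Binary.Disjoint.Propositional using (Disjoint)
open import Data.List.Relation.Binary.Permutation.Propositional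
  using (_↭_; ↭⇒↭ₛ; ↭-sym; ↭-trans; ↭-prep; ↭-swap; ↭-refl)
open import Data.List.Relation.Binary.Permutation.Propositional.Properties using (↭-length; ∈-resp-↭; shift; ++⁺ˡ)
import Data.List.Relation.Binary.Permutation.Setoid.Properties as PermutationSetoid
open import Data.List.Relation.Binary.Subset.Propositional using (_⊆_)
open import Data.List.Relation.Unary.All using (All; []; _∷_)
import Data.List.Relation.Unary.All as All
open import Data.List.Relation.Unary.AllPairs using ([]; _∷_)
open import Data.List.Relation.Unary.Any using (here; there)
import Data.List.Relation.Unary.Any as Any
open import Data.List.Relation.Unary.Unique.Propositional using (Unique)
open import Data.List.Relation.Unary.Unique.Propositional.Properties using (Unique[x∷xs]⇒x∉xs)
import Data.List.Relation.Unary.Unique.Propositional.Properties as Unique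
open import Data.Maybe using (Maybe; just; nothing)
open import Data.Nat using (ℕ; suc; _+_; _≤_; _<_; s≤s; _≤?_)
import Data.Nat as ℕ
open import Data.Nat.Induction using (<-wellFounded)
open import Data.Nat.Properties using (≤-trans; ≤-reflexive; n≮n)
open import Data.Product using (Σ; ∃; _×_; _,_; proj₁; proj₂)
open import Data.Sum using (_⊎_; inj₁; inj₂)
import Data.Sum as Sum
open import Function using (_∘_)
open import Function.Bundles using (mk⇔; Equivalence)
open import Induction.WellFounded using (Acc; acc)
open import Level using (Level)
open import Relation.Binary using (DecidableEquality)
open import Relation.Binary.PropositionalEquality using (_≡_; _≢_; refl; sym; trans; cong; cong₂; subst)
import Relation.Binary.PropositionalEquality as ≡
open import Relation.Nullary using (¬_; Dec; yes; no; ¬?; _×-dec_)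
open import Relation.Nullary.Decidable
  using (⌊_⌋; True; False; isYes≗does; dec-true; dec-false; decidable-stable; toWitness; toWitnessFalse; fromWitness)

private
  variable
    a : Level
    A : Set a

unique∧set⇒length≡ : {xs ys : List A} → Unique xs → Unique ys → xs ∼[ set ] ys → length xs ≡ length ys
unique∧set⇒length≡ xs! ys! xs∼ys = ↭-length (∼bag⇒↭ (unique∧set⇒bag xs! ys! xs∼ys))

Unique-resp-↭ : {xs ys : List A} → xs ↭ ys → Unique xs → Unique ys
Unique-resp-↭ = PermutationSetoid.Unique-resp-↭ (≡.setoid _) ∘ ↭⇒↭ₛ

module _ (_≟ᴬ_ : DecidableEquality A) where
  open import Data.List.Membership.DecPropositional _≟ᴬ_ using (_∈?_)

  unique∧⊆⇒length≤ : {xs ys : List A} → Unique xs → Unique ys → xs ⊆ ys → length xs ≤ length ys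
  unique∧⊆⇒length≤ {xs} {ys} xs! ys! xs⊆ys =
    ≤-trans (≤-reflexive (unique∧set⇒length≡ xs! (Unique.filter⁺ (_∈? xs) ys!) xs∼ys⁺))
            (length-filter (_∈? xs) ys)
    where
    xs∼ys⁺ : xs ∼[ set ] filter (_∈? xs) ys
    xs∼ys⁺ = mk⇔ (λ z∈xs → ∈-filter⁺ (_∈? xs) (xs⊆ys z∈xs) z∈xs) (proj₂ ∘ ∈-filter⁻ (_∈? xs) {xs = ys})

module _ {n : ℕ} where

  ≐-refl : {S : VSet n} → S ≐ S
  ≐-refl _ = (λ Sz → Sz) , (λ Sz → Sz)

  ≐-sym : {S T : VSet n} → S ≐ T → T ≐ S
  ≐-sym S≐T z = proj₂ (S≐T z) , proj₁ (S≐T z)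

  ≐-trans : {S T U : VSet n} → S ≐ T → T ≐ U → S ≐ U
  ≐-trans S≐T T≐U z = proj₁ (T≐U z) ∘ proj₁ (S≐T z) , proj₂ (S≐T z) ∘ proj₂ (T≐U z)

  ∪-cong : {S S′ T T′ : VSet n} → S ≐ S′ → T ≐ T′ → (S ∪ T) ≐ (S′ ∪ T′)
  ∪-cong S≐S′ T≐T′ z = Sum.map (proj₁ (S≐S′ z)) (proj₁ (T≐T′ z)) , Sum.map (proj₂ (S≐S′ z)) (proj₂ (T≐T′ z))

  ≐⇒∼set : {xs ys : List (Fin n)} → SetOf xs ≐ SetOf ys → xs ∼[ set ] ys
  ≐⇒∼set xs≐ys = mk⇔ (proj₁ (xs≐ys _)) (proj₂ (xs≐ys _))

  ↭⇒≐ : {xs ys : List (Fin n)} → xs ↭ ys → SetOf xs ≐ SetOf ys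
  ↭⇒≐ xs↭ys _ = ∈-resp-↭ xs↭ys , ∈-resp-↭ (↭-sym xs↭ys)

  ∷∷-++-≐ : ∀ {x y : Fin n} xs ys → SetOf (x ∷ y ∷ xs ++ ys) ≐ (SetOf (x ∷ y ∷ xs) ∪ SetOf (x ∷ y ∷ ys))
  ∷∷-++-≐ xs ys _ = split , merge
    where
    split : ∀ {z} → z ∈ _ ∷ _ ∷ xs ++ ys → z ∈ _ ∷ _ ∷ xs ⊎ z ∈ _ ∷ _ ∷ ys
    split (here z≡x) = inj₁ (here z≡x)
    split (there (here z≡y)) = inj₁ (there (here z≡y))
    split (there (there z∈)) = Sum.map (there ∘ there) (there ∘ there) (∈-++⁻ xs z∈)
    merge : ∀ {z} → z ∈ _ ∷ _ ∷ xs ⊎ z ∈ _ ∷ _ ∷ ys → z ∈ _ ∷ _ ∷ xs ++ ys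
    merge (inj₁ (here z≡x)) = here z≡x
    merge (inj₁ (there (here z≡y))) = there (here z≡y)
    merge (inj₁ (there (there z∈xs))) = there (there (∈-++⁺ˡ z∈xs))
    merge (inj₂ (here z≡x)) = here z≡x
    merge (inj₂ (there (here z≡y))) = there (here z≡y)
    merge (inj₂ (there (there z∈ys))) = there (there (∈-++⁺ʳ xs z∈ys))

  pair : Fin n → Fin n → VSet n
  pair x y = SetOf (x ∷ y ∷ [])

  ∉-pair : ∀ {x y z : Fin n} → z ≢ x → z ≢ y → ¬ pair x y z
  ∉-pair z≢x z≢y (here z≡x) = z≢x z≡x
  ∉-pair z≢x z≢y (there (here z≡y)) = z≢y z≡y

  pair-swap : ∀ {x y z : Fin n} → pair x y z → pair y x z
  pair-swap (here z≡x) = there (here z≡x)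
  pair-swap (there (here z≡y)) = here z≡y

  ∉-triple : ∀ {x y u z : Fin n} → z ≢ x → z ≢ y → z ≢ u → z ∉ x ∷ y ∷ u ∷ []
  ∉-triple z≢x _ _ (here z≡x) = z≢x z≡x
  ∉-triple _ z≢y _ (there (here z≡y)) = z≢y z≡y
  ∉-triple _ _ z≢u (there (there (here z≡u))) = z≢u z≡u

module Walks {n : ℕ} (G : Graph n) where

  module _ {S : VSet n} where

    path-target : ∀ {u w} → Path G S u w → ¬ S w
    path-target (here ¬Su) = ¬Su
    path-target (next _ _ ¬Sw) = ¬Sw

    path-source : ∀ {u w} → Path G S u w → ¬ S u
    path-source (here ¬Su) = ¬Su
    path-source (next q _ _) = path-source q

    _++ᵖ_ : ∀ {u v w} → Path G S u v → Path G S v w → Path G S u w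
    q ++ᵖ here _ = q
    q ++ᵖ next r vw ¬Sw = next (q ++ᵖ r) vw ¬Sw

    path-∷ : ∀ {u v w} → Adj G u v → ¬ S u → Path G S v w → Path G S u w
    path-∷ uv ¬Su q = next (here ¬Su) uv (path-source q) ++ᵖ q

    path-closed : ∀ {u w} (P : VSet n) → P u → (∀ {v w} → P v → Adj G v w → ¬ S w → P w) →
                  Path G S u w → P w
    path-closed P Pu closed (here _) = Pu
    path-closed P Pu closed (next q vw ¬Sw) = closed (path-closed P Pu closed q) vw ¬Sw

    path-weaken : ∀ {S′ : VSet n} {u w} → (∀ {v} → Path G S u v → ¬ S′ v) → Path G S u w → Path G S′ u w
    path-weaken avoids (here ¬Su) = here (avoids (here ¬Su))
    path-weaken avoids (next q vw ¬Sw) = next (path-weaken avoids q) vw (avoids (next q vw ¬Sw))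

    enclosed-path-trivial : ∀ {s t} → (∀ {z} → Adj G s z → S z) → Path G S s t → t ≡ s
    enclosed-path-trivial enclosed (here _) = refl
    enclosed-path-trivial enclosed (next q vt ¬St) with refl ← enclosed-path-trivial enclosed q =
      ⊥-elim (¬St (enclosed vt))

  path-pair-swap : ∀ {x y u w} → Path G (pair x y) u w → Path G (pair y x) u w
  path-pair-swap = path-weaken (λ q → path-target q ∘ pair-swap)

  -- s itself need not be a neighbour of u
  data NeighbourWalk (u s : Fin n) : Fin n → Set where
    start : NeighbourWalk u s s
    continue : ∀ {v t} → NeighbourWalk u s v → Adj G v t → Adj G u t → NeighbourWalk u s t

  _++ʷ_ : ∀ {u s v t} → NeighbourWalk u s v → NeighbourWalk u v t → NeighbourWalk u s t
  q ++ʷ start = q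
  q ++ʷ continue r vt ut = continue (q ++ʷ r) vt ut

  NeighbourhoodsConnected : Set
  NeighbourhoodsConnected = ∀ {u s t} → Adj G u s → Adj G u t → NeighbourWalk u s t

  CommonNeighboursSeparated : Set
  CommonNeighboursSeparated = ∀ {x y u w} → Adj G x y → Adj G u x → Adj G u y → Adj G w x → Adj G w y →
                              u ≢ w → ¬ Path G (pair x y) u w

module SimpleGraph {n : ℕ} {G : Graph n}
  (symmetric : ∀ i j → G i j ≡ G j i) (loopless : ∀ i → G i i ≡ false) where

  open Walks G

  adj-sym : ∀ {x y} → Adj G x y → Adj G y x
  adj-sym {x} {y} xy = trans (symmetric y x) xy

  adj⇒≢ : ∀ {x y} → Adj G x y → x ≢ y
  adj⇒≢ {x} xx refl with () ← trans (sym xx) (loopless x)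

  path-reverse : ∀ {S u w} → Path G S u w → Path G S w u
  path-reverse (here ¬Su) = here ¬Su
  path-reverse (next q vw ¬Sw) = path-∷ (adj-sym vw) ¬Sw (path-reverse q)

-- Structure of 2-trees

record TwoTreeLike {n : ℕ} (G : Graph n) : Set where
  field
    symmetric : ∀ i j → G i j ≡ G j i
    loopless : ∀ i → G i i ≡ false
    separated : Walks.CommonNeighboursSeparated G
    neighbourhoods-connected : Walks.NeighbourhoodsConnected G
    edge-in-triangle : ∀ {i j} → Adj G i j → ∃ λ c → Adj G i c × Adj G j c

module K₃ (G : Graph 3) (complete : ∀ i j → G i j ≡ not ⌊ i ≟ j ⌋) where

  open Walks G

  ≢⇒adj : ∀ {i j} → i ≢ j → Adj G i j
  ≢⇒adj {i} {j} i≢j = trans (complete i j) (cong not (trans (isYes≗does (i ≟ j)) (dec-false (i ≟ j) i≢j)))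

  loopless : ∀ i → G i i ≡ false
  loopless i = trans (complete i i) (cong not (trans (isYes≗does (i ≟ i)) (dec-true (i ≟ i) refl)))

  symmetric : ∀ i j → G i j ≡ G j i
  symmetric i j with i ≟ j
  ... | yes refl = refl
  ... | no i≢j = trans (≢⇒adj i≢j) (sym (≢⇒adj (i≢j ∘ sym)))

  open SimpleGraph symmetric loopless

  third : (i j : Fin 3) → ∃ λ k → k ≢ i × k ≢ j
  third zero zero = suc zero , (λ ()) , (λ ())
  third zero (suc zero) = suc (suc zero) , (λ ()) , (λ ())
  third zero (suc (suc zero)) = suc zero , (λ ()) , (λ ())
  third (suc zero) zero = suc (suc zero) , (λ ()) , (λ ())
  third (suc zero) (suc zero) = zero , (λ ()) , (λ ())
  third (suc zero) (suc (suc zero)) = zero , (λ ()) , (λ ())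
  third (suc (suc zero)) zero = suc zero , (λ ()) , (λ ())
  third (suc (suc zero)) (suc zero) = zero , (λ ()) , (λ ())
  third (suc (suc zero)) (suc (suc zero)) = zero , (λ ()) , (λ ())

  third-unique : ∀ {x y u w : Fin 3} → x ≢ y → u ≢ x → u ≢ y → w ≢ x → w ≢ y → u ≡ w
  third-unique {x} {y} {u} {w} x≢y u≢x u≢y w≢x w≢y with u ≟ w
  ... | yes u≡w = u≡w
  ... | no u≢w = ⊥-elim (n≮n 3 (unique∧⊆⇒length≤ _≟_ four-distinct (Unique.allFin⁺ 3) (λ _ → ∈-allFin _)))
    where
    four-distinct : Unique (x ∷ y ∷ u ∷ w ∷ [])
    four-distinct = (x≢y ∷ (u≢x ∘ sym) ∷ (w≢x ∘ sym) ∷ [])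
                  ∷ ((u≢y ∘ sym) ∷ (w≢y ∘ sym) ∷ []) ∷ (u≢w ∷ []) ∷ [] ∷ []

  twoTreeLike : TwoTreeLike G
  twoTreeLike = record
    { symmetric = symmetric
    ; loopless = loopless
    ; separated = λ xy ux uy wx wy u≢w _ →
        u≢w (third-unique (adj⇒≢ xy) (adj⇒≢ ux) (adj⇒≢ uy) (adj⇒≢ wx) (adj⇒≢ wy))
    ; neighbourhoods-connected = connected
    ; edge-in-triangle = λ {i} {j} _ → let (k , k≢i , k≢j) = third i j in
        k , ≢⇒adj (k≢i ∘ sym) , ≢⇒adj (k≢j ∘ sym)
    }
    where
    connected : NeighbourhoodsConnected
    connected {s = s} {t} _ ut with s ≟ t
    ... | yes refl = start
    ... | no s≢t = continue start (≢⇒adj s≢t) ut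

data Punched {n : ℕ} (p : Fin (suc n)) : Fin (suc n) → Set where
  fresh : Punched p p
  old : (j : Fin n) → Punched p (punchIn p j)

punched : ∀ {n} (p i : Fin (suc n)) → Punched p i
punched p i with p ≟ i
... | yes refl = fresh
... | no p≢i = subst (Punched p) (punchIn-punchOut p≢i) (old (punchOut p≢i))

≟-∨-true : ∀ {n} {j a b : Fin n} → (⌊ j ≟ a ⌋ ∨ ⌊ j ≟ b ⌋) ≡ true → j ≡ a ⊎ j ≡ b
≟-∨-true {j = j} {a} {b} =
  Sum.map (toWitness {a? = j ≟ a}) (toWitness {a? = j ≟ b}) ∘ Equivalence.to T-∨ ∘ Equivalence.from T-≡

≟-∨-true⁻ : ∀ {n} {j a b : Fin n} → j ≡ a ⊎ j ≡ b → (⌊ j ≟ a ⌋ ∨ ⌊ j ≟ b ⌋) ≡ true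
≟-∨-true⁻ {j = j} {a} {b} =
  Equivalence.to T-≡ ∘ Equivalence.from T-∨ ∘ Sum.map (fromWitness {a? = j ≟ a}) (fromWitness {a? = j ≟ b})

Diamond : ∀ {n} → Graph n → Set
Diamond {n} G = Σ (Fin n) λ x → Σ (Fin n) λ y → Σ (Fin n) λ u → Σ (Fin n) λ w →
  Triangle G x y u × Triangle G x y w × u ≢ w

module Extension {n : ℕ} {G : Graph n} {G′ : Graph (suc n)} {p : Fin (suc n)} {a b : Fin n}
  (old-tree : TwoTreeLike G) (ab : Adj G a b)
  (restrict : ∀ i j → G′ (punchIn p i) (punchIn p j) ≡ G i j)
  (fresh-row : ∀ j → G′ p (punchIn p j) ≡ (⌊ j ≟ a ⌋ ∨ ⌊ j ≟ b ⌋))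
  (fresh-column : ∀ j → G′ (punchIn p j) p ≡ (⌊ j ≟ a ⌋ ∨ ⌊ j ≟ b ⌋))
  (fresh-loop : G′ p p ≡ false) where

  open TwoTreeLike old-tree
  module Old where
    open Walks G public
    open SimpleGraph symmetric loopless public
  module New = Walks G′

  ι : Fin n → Fin (suc n)
  ι = punchIn p

  lift : ∀ {i j} → Adj G i j → Adj G′ (ι i) (ι j)
  lift {i} {j} ij = trans (restrict i j) ij

  lower : ∀ {i j} → Adj G′ (ι i) (ι j) → Adj G i j
  lower {i} {j} ij = trans (sym (restrict i j)) ij

  fresh-adj : ∀ {j} → Adj G′ p (ι j) → j ≡ a ⊎ j ≡ b
  fresh-adj {j} pj = ≟-∨-true (trans (sym (fresh-row j)) pj)

  adj-fresh : ∀ {j} → Adj G′ (ι j) p → j ≡ a ⊎ j ≡ b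
  adj-fresh {j} jp = ≟-∨-true (trans (sym (fresh-column j)) jp)

  fresh-adj⁻ : ∀ {j} → j ≡ a ⊎ j ≡ b → Adj G′ p (ι j)
  fresh-adj⁻ {j} j∈ab = trans (fresh-row j) (≟-∨-true⁻ j∈ab)

  adj-fresh⁻ : ∀ {j} → j ≡ a ⊎ j ≡ b → Adj G′ (ι j) p
  adj-fresh⁻ {j} j∈ab = trans (fresh-column j) (≟-∨-true⁻ j∈ab)

  ¬fresh-loop : ¬ Adj G′ p p
  ¬fresh-loop pp with () ← trans (sym pp) fresh-loop

  other-end : ∀ {j} → j ≡ a ⊎ j ≡ b → ∃ λ c → Adj G j c × (c ≡ a ⊎ c ≡ b)
  other-end (inj₁ refl) = b , ab , inj₂ refl
  other-end (inj₂ refl) = a , Old.adj-sym ab , inj₁ refl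

  distinct-in-ab⇒adj : ∀ {s t} → s ≡ a ⊎ s ≡ b → t ≡ a ⊎ t ≡ b → s ≢ t → Adj G s t
  distinct-in-ab⇒adj (inj₁ refl) (inj₁ refl) s≢t = ⊥-elim (s≢t refl)
  distinct-in-ab⇒adj (inj₁ refl) (inj₂ refl) _ = ab
  distinct-in-ab⇒adj (inj₂ refl) (inj₁ refl) _ = Old.adj-sym ab
  distinct-in-ab⇒adj (inj₂ refl) (inj₂ refl) s≢t = ⊥-elim (s≢t refl)

  other-in-ab-unique : ∀ {u w y} → u ≡ a ⊎ u ≡ b → w ≡ a ⊎ w ≡ b → y ≡ a ⊎ y ≡ b → u ≢ y → w ≢ y → u ≡ w
  other-in-ab-unique (inj₁ refl) (inj₁ refl) _ _ _ = refl
  other-in-ab-unique (inj₂ refl) (inj₂ refl) _ _ _ = refl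
  other-in-ab-unique (inj₁ refl) (inj₂ refl) (inj₁ refl) u≢y _ = ⊥-elim (u≢y refl)
  other-in-ab-unique (inj₁ refl) (inj₂ refl) (inj₂ refl) _ w≢y = ⊥-elim (w≢y refl)
  other-in-ab-unique (inj₂ refl) (inj₁ refl) (inj₁ refl) _ w≢y = ⊥-elim (w≢y refl)
  other-in-ab-unique (inj₂ refl) (inj₁ refl) (inj₂ refl) u≢y _ = ⊥-elim (u≢y refl)

  symmetric′ : ∀ i j → G′ i j ≡ G′ j i
  symmetric′ i j with punched p i | punched p j
  ... | fresh | fresh = refl
  ... | fresh | old j′ = trans (fresh-row j′) (sym (fresh-column j′))
  ... | old i′ | fresh = trans (fresh-column i′) (sym (fresh-row i′))
  ... | old i′ | old j′ = trans (restrict i′ j′) (trans (symmetric i′ j′) (sym (restrict j′ i′)))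

  loopless′ : ∀ i → G′ i i ≡ false
  loopless′ i with punched p i
  ... | fresh = fresh-loop
  ... | old i′ = trans (restrict i′ i′) (loopless i′)

  open SimpleGraph symmetric′ loopless′

  edge-in-triangle′ : ∀ {i j} → Adj G′ i j → ∃ λ c → Adj G′ i c × Adj G′ j c
  edge-in-triangle′ {i} {j} ij with punched p i | punched p j
  ... | fresh | fresh = ⊥-elim (¬fresh-loop ij)
  ... | fresh | old j′ = let (c , j′c , c∈ab) = other-end (fresh-adj ij) in ι c , fresh-adj⁻ c∈ab , lift j′c
  ... | old i′ | fresh = let (c , i′c , c∈ab) = other-end (adj-fresh ij) in ι c , lift i′c , fresh-adj⁻ c∈ab
  ... | old i′ | old j′ = let (c , i′c , j′c) = edge-in-triangle (lower ij) in ι c , lift i′c , lift j′c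

  lift-walk : ∀ {u s t} → Old.NeighbourWalk u s t → New.NeighbourWalk (ι u) (ι s) (ι t)
  lift-walk Old.start = New.start
  lift-walk (Old.continue q vt ut) = New.continue (lift-walk q) (lift vt) (lift ut)

  neighbourhoods-connected′ : New.NeighbourhoodsConnected
  neighbourhoods-connected′ {u} {s} {t} us ut with punched p u | punched p s | punched p t
  ... | fresh | fresh | _ = ⊥-elim (¬fresh-loop us)
  ... | fresh | old _ | fresh = ⊥-elim (¬fresh-loop ut)
  ... | fresh | old s′ | old t′ with s′ ≟ t′
  ...   | yes refl = New.start
  ...   | no s′≢t′ = New.continue New.start (lift (distinct-in-ab⇒adj (fresh-adj us) (fresh-adj ut) s′≢t′)) ut
  neighbourhoods-connected′ us ut | old _ | fresh | fresh = New.start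
  neighbourhoods-connected′ us ut | old u′ | fresh | old t′ =
    let (c , u′c , c∈ab) = other-end (adj-fresh us) in
    New.continue New.start (fresh-adj⁻ c∈ab) (lift u′c) New.++ʷ lift-walk (neighbourhoods-connected u′c (lower ut))
  neighbourhoods-connected′ us ut | old u′ | old s′ | fresh =
    let (c , u′c , c∈ab) = other-end (adj-fresh ut) in
    New.continue (lift-walk (neighbourhoods-connected (lower us) u′c)) (adj-fresh⁻ c∈ab) ut
  neighbourhoods-connected′ us ut | old _ | old _ | old _ = lift-walk (neighbourhoods-connected (lower us) (lower ut))

  lower-∉ : ∀ {x y v} → ¬ pair (ι x) (ι y) (ι v) → ¬ pair x y v
  lower-∉ ∉xy (here v≡x) = ∉xy (here (cong ι v≡x))
  lower-∉ ∉xy (there (here v≡y)) = ∉xy (there (here (cong ι v≡y)))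

  -- a detour through the fresh vertex enters and leaves it via a and b, which are adjacent
  project : ∀ {x y s t′} → Path G′ (pair (ι x) (ι y)) (ι s) t′ →
            (∀ t → t′ ≡ ι t → Path G (pair x y) s t) ×
            (t′ ≡ p → Path G (pair x y) s a ⊎ Path G (pair x y) s b)
  project {x} {y} {s} (here ∉xy) =
    (λ t ιs≡ιt → subst (Path G (pair x y) s) (punchIn-injective p s t ιs≡ιt) (here (lower-∉ ∉xy))) ,
    (λ ιs≡p → ⊥-elim (punchInᵢ≢i p s ιs≡p))
  project {x} {y} {s} {t′} (next {v′} q v′t′ ∉xy) with punched p v′
  ... | fresh = at-old , λ t′≡p → ⊥-elim (¬fresh-loop (subst (Adj G′ p) t′≡p v′t′))
    where
    at-old : ∀ t → t′ ≡ ι t → Path G (pair x y) s t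
    at-old t refl with fresh-adj v′t′ | proj₂ (project q) refl
    ... | inj₁ refl | inj₁ s⇝a = s⇝a
    ... | inj₁ refl | inj₂ s⇝b = next s⇝b (Old.adj-sym ab) (lower-∉ ∉xy)
    ... | inj₂ refl | inj₁ s⇝a = next s⇝a ab (lower-∉ ∉xy)
    ... | inj₂ refl | inj₂ s⇝b = s⇝b
  ... | old v = at-old , at-fresh
    where
    s⇝v : Path G (pair x y) s v
    s⇝v = proj₁ (project q) v refl
    at-old : ∀ t → t′ ≡ ι t → Path G (pair x y) s t
    at-old t refl = next s⇝v (lower v′t′) (lower-∉ ∉xy)
    at-fresh : t′ ≡ p → Path G (pair x y) s a ⊎ Path G (pair x y) s b
    at-fresh refl with adj-fresh v′t′
    ... | inj₁ refl = inj₁ s⇝v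
    ... | inj₂ refl = inj₂ s⇝v

  fresh-enclosed : ∀ {x y} → x ≡ a ⊎ x ≡ b → y ≡ a ⊎ y ≡ b → x ≢ y → ∀ {z} → Adj G′ p z → pair (ι x) (ι y) z
  fresh-enclosed x∈ab y∈ab x≢y {z} pz with punched p z
  ... | fresh = ⊥-elim (¬fresh-loop pz)
  ... | old z′ with fresh-adj pz | x∈ab | y∈ab
  ...   | inj₁ refl | inj₁ refl | _ = here refl
  ...   | inj₁ refl | inj₂ refl | inj₁ refl = there (here refl)
  ...   | inj₁ refl | inj₂ refl | inj₂ refl = ⊥-elim (x≢y refl)
  ...   | inj₂ refl | inj₂ refl | _ = here refl
  ...   | inj₂ refl | inj₁ refl | inj₂ refl = there (here refl)
  ...   | inj₂ refl | inj₁ refl | inj₁ refl = ⊥-elim (x≢y refl)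

  separated′ : New.CommonNeighboursSeparated
  separated′ {x} {y} {u} {w} xy ux uy wx wy u≢w u⇝w with punched p x | punched p y
  ... | fresh | fresh = ¬fresh-loop xy
  ... | fresh | old y′ with punched p u | punched p w
  ...   | fresh | _ = ¬fresh-loop ux
  ...   | old _ | fresh = ¬fresh-loop wx
  ...   | old u′ | old w′ = u≢w (cong ι (other-in-ab-unique (adj-fresh ux) (adj-fresh wx) (fresh-adj xy)
                                         (adj⇒≢ uy ∘ cong ι) (adj⇒≢ wy ∘ cong ι)))
  separated′ {u = u} {w} xy ux uy wx wy u≢w u⇝w | old x′ | fresh with punched p u | punched p w
  ...   | fresh | _ = ¬fresh-loop uy
  ...   | old _ | fresh = ¬fresh-loop wy
  ...   | old u′ | old w′ = u≢w (cong ι (other-in-ab-unique (adj-fresh uy) (adj-fresh wy) (adj-fresh xy)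
                                         (adj⇒≢ ux ∘ cong ι) (adj⇒≢ wx ∘ cong ι)))
  separated′ {u = u} {w} xy ux uy wx wy u≢w u⇝w | old x′ | old y′ with punched p u | punched p w
  ...   | fresh | fresh = u≢w refl
  ...   | fresh | old w′ = punchInᵢ≢i p w′
          (New.enclosed-path-trivial (fresh-enclosed (fresh-adj ux) (fresh-adj uy) (adj⇒≢ xy ∘ cong ι)) u⇝w)
  ...   | old u′ | fresh = punchInᵢ≢i p u′
          (New.enclosed-path-trivial (fresh-enclosed (fresh-adj wx) (fresh-adj wy) (adj⇒≢ xy ∘ cong ι)) (path-reverse u⇝w))
  ...   | old u′ | old w′ = separated (lower xy) (lower ux) (lower uy) (lower wx) (lower wy) (u≢w ∘ cong ι)
                              (proj₁ (project u⇝w) w′ refl)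

  twoTreeLike : TwoTreeLike G′
  twoTreeLike = record
    { symmetric = symmetric′
    ; loopless = loopless′
    ; separated = separated′
    ; neighbourhoods-connected = neighbourhoods-connected′
    ; edge-in-triangle = edge-in-triangle′
    }

  diamond : Diamond G′
  diamond = let (c , ac , bc) = edge-in-triangle ab in
    ι a , ι b , ι c , p , (lift ab , lift bc , lift ac) , (lift ab , adj-fresh⁻ (inj₂ refl) , adj-fresh⁻ (inj₁ refl)) ,
    punchInᵢ≢i p c

twoTreeLike : ∀ {n G} → TwoTree n G → TwoTreeLike G
twoTreeLike (base G complete) = K₃.twoTreeLike G complete
twoTreeLike (step G G′ p a b tree ab restrict row column loop) =
  Extension.twoTreeLike (twoTreeLike tree) ab restrict row column loop

twoTree-diamond : ∀ {n G} → TwoTree n G → 4 ≤ n → Diamond G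
twoTree-diamond (base G _) (s≤s (s≤s (s≤s ())))
twoTree-diamond (step G G′ p a b tree ab restrict row column loop) _ =
  Extension.diamond (twoTreeLike tree) ab restrict row column loop

-- Branches

module Branches {n : ℕ} {G : Graph n} (tree : TwoTreeLike G) where

  open TwoTreeLike tree
  open Walks G
  open SimpleGraph symmetric loopless

  interior : ∀ k {v₁ v₂ u₀} → IsKind G k v₁ v₂ u₀ → List (Fin n)
  interior ear {u₀ = u₀} _ = u₀ ∷ []
  interior hat {u₀ = u₀} (_ , u₁ , u₂ , _) = u₀ ∷ u₁ ∷ u₂ ∷ []
  interior dhat {u₀ = u₀} (_ , u₁ , u₂ , u₃ , u₄ , u₅ , u₆ , _) = u₀ ∷ u₁ ∷ u₂ ∷ u₃ ∷ u₄ ∷ u₅ ∷ u₆ ∷ []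

  interiorSize : Kind → ℕ
  interiorSize ear = 1
  interiorSize hat = 3
  interiorSize dhat = 7

  length-interior : ∀ k {v₁ v₂ u₀} (κ : IsKind G k v₁ v₂ u₀) → length (interior k κ) ≡ interiorSize k
  length-interior ear _ = refl
  length-interior hat _ = refl
  length-interior dhat _ = refl

  kind-isBranch : ∀ k {v₁ v₂ u₀} → IsKind G k v₁ v₂ u₀ → IsBranch G v₁ v₂ u₀
  kind-isBranch ear = proj₁
  kind-isBranch hat = proj₁
  kind-isBranch dhat = proj₁

  kind-unique : ∀ k {v₁ v₂ u₀} (κ : IsKind G k v₁ v₂ u₀) → Unique (v₁ ∷ v₂ ∷ interior k κ)
  kind-unique ear (_ , unique , _) = unique
  kind-unique hat (_ , _ , _ , unique , _) = unique
  kind-unique dhat (_ , _ , _ , _ , _ , _ , _ , unique , _) = unique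

  kind-branch : ∀ k {v₁ v₂ u₀} (κ : IsKind G k v₁ v₂ u₀) → BranchSet G v₁ v₂ u₀ ≐ SetOf (v₁ ∷ v₂ ∷ interior k κ)
  kind-branch ear (_ , _ , branch , _) = branch
  kind-branch hat (_ , _ , _ , _ , branch , _) = branch
  kind-branch dhat (_ , _ , _ , _ , _ , _ , _ , _ , branch , _) = branch

  interior-unique : ∀ k {v₁ v₂ u₀} (κ : IsKind G k v₁ v₂ u₀) → Unique (interior k κ)
  interior-unique k κ = Unique.drop⁺ 2 (kind-unique k κ)

  interior-∌ : ∀ k {v₁ v₂ u₀ z} (κ : IsKind G k v₁ v₂ u₀) → z ∈ interior k κ → ¬ pair v₁ v₂ z
  interior-∌ k κ z∈ (here refl) = Unique[x∷xs]⇒x∉xs (kind-unique k κ) (there z∈)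
  interior-∌ k κ z∈ (there (here refl)) with _ ∷ v₂∷I! ← kind-unique k κ = Unique[x∷xs]⇒x∉xs v₂∷I! z∈

  interior⇒path : ∀ k {v₁ v₂ u₀ z} (κ : IsKind G k v₁ v₂ u₀) → z ∈ interior k κ → Path G (pair v₁ v₂) u₀ z
  interior⇒path k κ z∈ with proj₂ (kind-branch k κ _) (there (there z∈))
  ... | inj₁ refl = ⊥-elim (interior-∌ k κ z∈ (here refl))
  ... | inj₂ (inj₁ refl) = ⊥-elim (interior-∌ k κ z∈ (there (here refl)))
  ... | inj₂ (inj₂ u₀⇝z) = u₀⇝z

  path⇒interior : ∀ k {v₁ v₂ u₀ z} (κ : IsKind G k v₁ v₂ u₀) → Path G (pair v₁ v₂) u₀ z → z ∈ interior k κ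
  path⇒interior k κ u₀⇝z with proj₁ (kind-branch k κ _) (inj₂ (inj₂ u₀⇝z))
  ... | here refl = ⊥-elim (path-target u₀⇝z (here refl))
  ... | there (here refl) = ⊥-elim (path-target u₀⇝z (there (here refl)))
  ... | there (there z∈) = z∈

  Witness : Set₁
  Witness = Σ (VSet n) λ H → (InH2 G H ⊎ InT2 G H) × ¬ IsHatOf G H × ¬ IsDoubleHatOf G H

  kind-size : ∀ k {v₁ v₂ u₀} {H : VSet n} {L : List (Fin n)} → IsKind G k v₁ v₂ u₀ → H ≐ BranchSet G v₁ v₂ u₀ →
              Unique L → H ≐ SetOf L → length L ≡ 2 + interiorSize k
  kind-size k κ H≐B L! H≐L =
    trans (unique∧set⇒length≡ L! (kind-unique k κ) (≐⇒∼set (≐-trans (≐-sym H≐L) (≐-trans H≐B (kind-branch k κ)))))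
          (cong (2 +_) (length-interior k κ))

  witness : (H : VSet n) {L : List (Fin n)} → InH2 G H ⊎ InT2 G H → Unique L → H ≐ SetOf L →
            length L ≢ 5 → length L ≢ 9 → Witness
  witness H member L! H≐L ≢5 ≢9 =
    H , member ,
    (λ { (_ , _ , _ , κ , H≐B) → ≢5 (kind-size hat κ H≐B L! H≐L) }) ,
    (λ { (_ , _ , _ , κ , H≐B) → ≢9 (kind-size dhat κ H≐B L! H≐L) })

  total : ℕ × ℕ × ℕ → ℕ
  total (a , b , c) = a + b + c

  two-kinds : ∀ k₁ k₂ → let size = 2 + interiorSize k₁ + interiorSize k₂ in
              total (count (k₁ ∷ k₂ ∷ [])) ≡ 2 × size ≢ 5 × size ≢ 9
  two-kinds ear ear = refl , (λ ()) , (λ ())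
  two-kinds ear hat = refl , (λ ()) , (λ ())
  two-kinds ear dhat = refl , (λ ()) , (λ ())
  two-kinds hat ear = refl , (λ ()) , (λ ())
  two-kinds hat hat = refl , (λ ()) , (λ ())
  two-kinds hat dhat = refl , (λ ()) , (λ ())
  two-kinds dhat ear = refl , (λ ()) , (λ ())
  two-kinds dhat hat = refl , (λ ()) , (λ ())
  two-kinds dhat dhat = refl , (λ ()) , (λ ())

  twoBranches-witness : ∀ k₁ k₂ {v₁ v₂ u₀ w₀} → IsKind G k₁ v₁ v₂ u₀ → IsKind G k₂ v₁ v₂ w₀ → u₀ ≢ w₀ → Witness
  twoBranches-witness k₁ k₂ {v₁} {v₂} {u₀} {w₀} κ₁ κ₂ u₀≢w₀
    with kind-isBranch k₁ κ₁ | kind-isBranch k₂ κ₂ | two-kinds k₁ k₂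
  ... | v₁≢v₂ , v₁v₂ , u₀v₁ , u₀v₂ | _ , _ , w₀v₁ , w₀v₂ | total≡2 , ≢5 , ≢9 =
    witness H (inj₂ inT2) L! H≐L (≢5 ∘ trans (sym length-L)) (≢9 ∘ trans (sym length-L))
    where
    I₁ = interior k₁ κ₁
    I₂ = interior k₂ κ₂
    H : VSet n
    H = BranchSet G v₁ v₂ u₀ ∪ BranchSet G v₁ v₂ w₀
    counts = count (k₁ ∷ k₂ ∷ [])
    inT2 : InT2 G H
    inT2 = proj₁ counts , proj₁ (proj₂ counts) , proj₂ (proj₂ counts) , total≡2 , v₁ , v₂ , u₀ , w₀ ,
           ((v₁v₂ , adj-sym u₀v₂ , adj-sym u₀v₁) , (v₁v₂ , adj-sym w₀v₂ , adj-sym w₀v₁) , u₀≢w₀ ,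
            k₁ , k₂ , κ₁ , κ₂ , refl) ,
           ≐-refl
    H≐L : H ≐ SetOf (v₁ ∷ v₂ ∷ I₁ ++ I₂)
    H≐L = ≐-trans (∪-cong (kind-branch k₁ κ₁) (kind-branch k₂ κ₂)) (≐-sym (∷∷-++-≐ I₁ I₂))
    I₁∩I₂=∅ : Disjoint I₁ I₂
    I₁∩I₂=∅ (z∈I₁ , z∈I₂) = separated v₁v₂ u₀v₁ u₀v₂ w₀v₁ w₀v₂ u₀≢w₀
      (interior⇒path k₁ κ₁ z∈I₁ ++ᵖ path-reverse (interior⇒path k₂ κ₂ z∈I₂))
    L! : Unique (v₁ ∷ v₂ ∷ I₁ ++ I₂)
    L! = Unique.++⁺ ((v₁≢v₂ ∷ []) ∷ [] ∷ [])
                    (Unique.++⁺ (interior-unique k₁ κ₁) (interior-unique k₂ κ₂) I₁∩I₂=∅)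
                    (λ (z∈v₁v₂ , z∈I) → Sum.[ (λ z∈I₁ → interior-∌ k₁ κ₁ z∈I₁ z∈v₁v₂)
                                            , (λ z∈I₂ → interior-∌ k₂ κ₂ z∈I₂ z∈v₁v₂) ] (∈-++⁻ I₁ z∈I))
    length-L : length (v₁ ∷ v₂ ∷ I₁ ++ I₂) ≡ 2 + interiorSize k₁ + interiorSize k₂
    length-L = cong (2 +_) (trans (length-++ I₁) (cong₂ _+_ (length-interior k₁ κ₁) (length-interior k₂ κ₂)))

  -- z lies in a branch B({v,u},t) with t ≠ o
  Beyond : Fin n → Fin n → Fin n → VSet n
  Beyond v u o z = ∃ λ t → Adj G v t × Adj G u t × t ≢ o × Path G (pair v u) t z

  triangle-swap : ∀ {x y u} → Triangle G x y u → Triangle G y x u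
  triangle-swap (xy , yu , xu) = adj-sym xy , xu , yu

  beyond-extend : ∀ {v u o z w} → Beyond v u o z → Adj G z w → w ≢ v → w ≢ u → Beyond v u o w
  beyond-extend (t , vt , ut , t≢o , t⇝z) zw w≢v w≢u = t , vt , ut , t≢o , next t⇝z zw (∉-pair w≢v w≢u)

  module _ {v o u} (△ : Triangle G v o u) where

    private
      vo = proj₁ △
      ou = proj₁ (proj₂ △)
      vu = proj₂ (proj₂ △)

    beyond-≢ : ∀ {z} → Beyond v u o z → z ≢ v × z ≢ o × z ≢ u
    beyond-≢ (t , vt , ut , t≢o , t⇝z) =
      path-target t⇝z ∘ here ,
      (λ { refl → separated vu (adj-sym vt) (adj-sym ut) (adj-sym vo) ou t≢o t⇝z }) ,
      path-target t⇝z ∘ there ∘ here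

    beyond⇒path : ∀ {z} → Beyond v u o z → Path G (pair v o) u z
    beyond⇒path (t , vt , ut , t≢o , t⇝z) =
      path-∷ ut (∉-pair (adj⇒≢ (adj-sym vu)) (adj⇒≢ (adj-sym ou)))
        (path-weaken (λ t⇝w → ∉-pair (proj₁ (avoid t⇝w)) (proj₁ (proj₂ (avoid t⇝w)))) t⇝z)
      where
      avoid : ∀ {w} → Path G (pair v u) t w → w ≢ v × w ≢ o × w ≢ u
      avoid t⇝w = beyond-≢ (t , vt , ut , t≢o , t⇝w)

  module _ {x y u} (△ : Triangle G x y u) where

    private
      xy = proj₁ △
      yu = proj₁ (proj₂ △)
      xu = proj₂ (proj₂ △)

    beyond-disjoint : ∀ {z} → Beyond x u y z → Beyond y u x z → ⊥
    beyond-disjoint x-side (t , yt , ut , t≢x , t⇝z) = walk-back t⇝z x-side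
      where
      walk-back : ∀ {z} → Path G (pair y u) t z → Beyond x u y z → ⊥
      walk-back (here _) x-side =
        proj₁ (proj₂ (beyond-≢ △ (beyond-extend x-side (adj-sym yt) (adj⇒≢ (adj-sym xy)) (adj⇒≢ yu)))) refl
      walk-back (next {v} t⇝v vz _) x-side with v ≟ x
      ... | yes refl = proj₁ (proj₂ (beyond-≢ (triangle-swap △) (t , yt , ut , t≢x , t⇝v))) refl
      ... | no v≢x = walk-back t⇝v (beyond-extend x-side (adj-sym vz) v≢x (path-target t⇝v ∘ there ∘ here))

    neighbour-split : ∀ {z} → Adj G u z → z ≡ x ⊎ z ≡ y ⊎ Beyond x u y z ⊎ Beyond y u x z
    neighbour-split {z} uz with z ≟ x | z ≟ y
    ... | yes z≡x | _ = inj₁ z≡x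
    ... | no _ | yes z≡y = inj₂ (inj₁ z≡y)
    ... | no z≢x | no z≢y = inj₂ (inj₂ (walk-split (neighbourhoods-connected (adj-sym xu) uz) z≢x z≢y))
      where
      -- the last vertex of the walk in {x, y} roots the branch containing its tail
      walk-split : ∀ {t} → NeighbourWalk u x t → t ≢ x → t ≢ y → Beyond x u y t ⊎ Beyond y u x t
      walk-split start t≢x _ = ⊥-elim (t≢x refl)
      walk-split (continue {v} q vt ut) t≢x t≢y with v ≟ x | v ≟ y
      ... | yes refl | _ = inj₁ (_ , vt , ut , t≢y , here (∉-pair t≢x (adj⇒≢ ut ∘ sym)))
      ... | no _ | yes refl = inj₂ (_ , vt , ut , t≢x , here (∉-pair t≢y (adj⇒≢ ut ∘ sym)))
      ... | no v≢x | no v≢y =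
        Sum.map (λ b → beyond-extend b vt t≢x (adj⇒≢ ut ∘ sym)) (λ b → beyond-extend b vt t≢y (adj⇒≢ ut ∘ sym))
                (walk-split q v≢x v≢y)

    branch-split : ∀ {z} → BranchSet G x y u z → z ≡ x ⊎ z ≡ y ⊎ z ≡ u ⊎ Beyond x u y z ⊎ Beyond y u x z
    branch-split (inj₁ z≡x) = inj₁ z≡x
    branch-split (inj₂ (inj₁ z≡y)) = inj₂ (inj₁ z≡y)
    branch-split (inj₂ (inj₂ u⇝z)) = inj₂ (inj₂ (path-closed _ (inj₁ refl) closed u⇝z))
      where
      closed : ∀ {v w} → v ≡ u ⊎ Beyond x u y v ⊎ Beyond y u x v → Adj G v w → ¬ pair x y w →
               w ≡ u ⊎ Beyond x u y w ⊎ Beyond y u x w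
      closed {w = w} (inj₁ refl) uw w∉xy with neighbour-split uw
      ... | inj₁ refl = ⊥-elim (w∉xy (here refl))
      ... | inj₂ (inj₁ refl) = ⊥-elim (w∉xy (there (here refl)))
      ... | inj₂ (inj₂ beyond) = inj₂ beyond
      closed {w = w} (inj₂ beyond) vw w∉xy with w ≟ u
      ... | yes w≡u = inj₁ w≡u
      ... | no w≢u = inj₂ (Sum.map (λ b → beyond-extend b vw (w∉xy ∘ here) w≢u)
                                   (λ b → beyond-extend b vw (w∉xy ∘ there ∘ here) w≢u) beyond)

  sideInterior : ∀ {v o u} s → Side G v o u s → List (Fin n)
  sideInterior nothing _ = []
  sideInterior (just k) (_ , _ , _ , κ) = interior k κ

  sideSize : Maybe Kind → ℕ
  sideSize nothing = 0
  sideSize (just k) = interiorSize k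

  length-sideInterior : ∀ {v o u} s (σ : Side G v o u s) → length (sideInterior s σ) ≡ sideSize s
  length-sideInterior nothing _ = refl
  length-sideInterior (just k) (_ , _ , _ , κ) = length-interior k κ

  sideInterior-unique : ∀ {v o u} s (σ : Side G v o u s) → Unique (sideInterior s σ)
  sideInterior-unique nothing _ = []
  sideInterior-unique (just k) (_ , _ , _ , κ) = interior-unique k κ

  sideInterior⇒beyond : ∀ {v o u z} s (σ : Side G v o u s) → z ∈ sideInterior s σ → Beyond v u o z
  sideInterior⇒beyond (just k) (t , t≢o , _ , κ) z∈ with kind-isBranch k κ
  ... | _ , _ , tv , tu = t , adj-sym tv , adj-sym tu , t≢o , interior⇒path k κ z∈

  beyond⇒sideInterior : ∀ {v o u z} s (σ : Side G v o u s) → Beyond v u o z → z ∈ sideInterior s σ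
  beyond⇒sideInterior nothing common (t , vt , ut , t≢o , _) with proj₁ (common t) (ut , vt)
  ... | here t≡o = ⊥-elim (t≢o t≡o)
  beyond⇒sideInterior (just k) (_ , _ , common , κ) (t , vt , ut , t≢o , t⇝z) with proj₁ (common t) (ut , vt)
  ... | here t≡o = ⊥-elim (t≢o t≡o)
  ... | there (here refl) = path⇒interior k κ t⇝z

  module Sides {x y u} (△ : Triangle G x y u) {s₁ s₂} (σ₁ : Side G x y u s₁) (σ₂ : Side G y x u s₂) where

    private
      xy = proj₁ △
      yu = proj₁ (proj₂ △)
      xu = proj₂ (proj₂ △)
      I₁ = sideInterior s₁ σ₁
      I₂ = sideInterior s₂ σ₂

    vertices : List (Fin n)
    vertices = x ∷ y ∷ u ∷ I₁ ++ I₂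

    branch≐vertices : BranchSet G x y u ≐ SetOf vertices
    branch≐vertices z = to , from
      where
      to : BranchSet G x y u z → z ∈ vertices
      to b with branch-split △ b
      ... | inj₁ z≡x = here z≡x
      ... | inj₂ (inj₁ z≡y) = there (here z≡y)
      ... | inj₂ (inj₂ (inj₁ z≡u)) = there (there (here z≡u))
      ... | inj₂ (inj₂ (inj₂ (inj₁ b₁))) = there (there (there (∈-++⁺ˡ (beyond⇒sideInterior s₁ σ₁ b₁))))
      ... | inj₂ (inj₂ (inj₂ (inj₂ b₂))) = there (there (there (∈-++⁺ʳ I₁ (beyond⇒sideInterior s₂ σ₂ b₂))))
      from : z ∈ vertices → BranchSet G x y u z
      from (here z≡x) = inj₁ z≡x
      from (there (here z≡y)) = inj₂ (inj₁ z≡y)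
      from (there (there (here refl))) = inj₂ (inj₂ (here (∉-pair (adj⇒≢ (adj-sym xu)) (adj⇒≢ (adj-sym yu)))))
      from (there (there (there z∈I))) with ∈-++⁻ I₁ z∈I
      ... | inj₁ z∈I₁ = inj₂ (inj₂ (beyond⇒path △ (sideInterior⇒beyond s₁ σ₁ z∈I₁)))
      ... | inj₂ z∈I₂ = inj₂ (inj₂ (path-pair-swap (beyond⇒path (triangle-swap △) (sideInterior⇒beyond s₂ σ₂ z∈I₂))))

    vertices-unique : Unique vertices
    vertices-unique =
      Unique.++⁺ ((adj⇒≢ xy ∷ adj⇒≢ xu ∷ []) ∷ (adj⇒≢ yu ∷ []) ∷ [] ∷ [])
                 (Unique.++⁺ (sideInterior-unique s₁ σ₁) (sideInterior-unique s₂ σ₂)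
                   (λ (z∈I₁ , z∈I₂) → beyond-disjoint △ (sideInterior⇒beyond s₁ σ₁ z∈I₁)
                                                       (sideInterior⇒beyond s₂ σ₂ z∈I₂)))
                 (λ (z∈xyu , z∈I) → outside-triangle z∈I z∈xyu)
      where
      outside-triangle : ∀ {z} → z ∈ I₁ ++ I₂ → z ∉ x ∷ y ∷ u ∷ []
      outside-triangle z∈I with ∈-++⁻ I₁ z∈I
      ... | inj₁ z∈I₁ = let (z≢x , z≢y , z≢u) = beyond-≢ △ (sideInterior⇒beyond s₁ σ₁ z∈I₁) in ∉-triple z≢x z≢y z≢u
      ... | inj₂ z∈I₂ = let (z≢y , z≢x , z≢u) = beyond-≢ (triangle-swap △) (sideInterior⇒beyond s₂ σ₂ z∈I₂) in
                        ∉-triple z≢x z≢y z≢u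

    length-vertices : length vertices ≡ 3 + sideSize s₁ + sideSize s₂
    length-vertices =
      cong (3 +_) (trans (length-++ I₁) (cong₂ _+_ (length-sideInterior s₁ σ₁) (length-sideInterior s₂ σ₂)))

    neighbours : ∀ {z} → Adj G u z → z ∈ x ∷ y ∷ I₁ ++ I₂
    neighbours uz with neighbour-split △ uz
    ... | inj₁ z≡x = here z≡x
    ... | inj₂ (inj₁ z≡y) = there (here z≡y)
    ... | inj₂ (inj₂ (inj₁ b₁)) = there (there (∈-++⁺ˡ (beyond⇒sideInterior s₁ σ₁ b₁)))
    ... | inj₂ (inj₂ (inj₂ b₂)) = there (there (∈-++⁺ʳ I₁ (beyond⇒sideInterior s₂ σ₂ b₂)))

  triangle⇒isBranch : ∀ {x y u} → Triangle G x y u → IsBranch G x y u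
  triangle⇒isBranch (xy , yu , xu) = adj⇒≢ xy , xy , adj-sym xu , adj-sym yu

  neighbourhood-≐ : ∀ {u} {xs : List (Fin n)} → (∀ {z} → Adj G u z → z ∈ xs) → All (Adj G u) xs → N G u ≐ SetOf xs
  neighbourhood-≐ ⊆xs adjacent _ = ⊆xs , All.lookup adjacent

  ∉-neighbourhood : ∀ {a p q u} → N G a ≐ SetOf (p ∷ q ∷ []) → u ≢ p → u ≢ q → ¬ Adj G u a
  ∉-neighbourhood N-a u≢p u≢q ua = ∉-pair u≢p u≢q (proj₁ (N-a _) (adj-sym ua))

  ear-of-sides : ∀ {x y u} → Triangle G x y u → Side G x y u nothing → Side G y x u nothing → Ear G x y u
  ear-of-sides △@(_ , yu , xu) σ₁ σ₂ =
    triangle⇒isBranch △ , vertices-unique , branch≐vertices , neighbourhood-≐ neighbours (adj-sym xu ∷ adj-sym yu ∷ [])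
    where open Sides △ σ₁ σ₂

  hat-of-sides : ∀ {x y u} → Triangle G x y u → Side G x y u (just ear) → Side G y x u (just ear) → Hat G x y u
  hat-of-sides △@(_ , yu , xu) σ₁@(t₁ , _ , _ , ((_ , _ , _ , t₁u) , _ , _ , N-t₁))
                               σ₂@(t₂ , _ , _ , ((_ , _ , _ , t₂u) , _ , _ , N-t₂)) =
    triangle⇒isBranch △ , t₁ , t₂ , vertices-unique , branch≐vertices ,
    neighbourhood-≐ neighbours (adj-sym xu ∷ adj-sym yu ∷ adj-sym t₁u ∷ adj-sym t₂u ∷ []) , N-t₁ , N-t₂
    where open Sides △ {just ear} {just ear} σ₁ σ₂

  doubleHat-of-sides : ∀ {x y u} → Triangle G x y u → Side G x y u (just hat) → Side G y x u (just hat) →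
                       DoubleHat G x y u
  doubleHat-of-sides {x} {y} {u} △@(_ , yu , xu)
    σ₁@(t₁ , _ , _ , ((_ , _ , _ , t₁u) , a₁ , b₁ , _ , _ , N-t₁ , N-a₁ , N-b₁))
    σ₂@(t₂ , _ , _ , ((_ , _ , _ , t₂u) , a₂ , b₂ , _ , _ , N-t₂ , N-a₂ , N-b₂)) =
    triangle⇒isBranch △ , t₁ , t₂ , a₁ , b₁ , b₂ , a₂ ,
    Unique-resp-↭ reorder vertices-unique , ≐-trans branch≐vertices (↭⇒≐ reorder) ,
    neighbourhood-≐ (λ uz → prune uz (neighbours uz))
      (adj-sym xu ∷ adj-sym yu ∷ adj-sym t₁u ∷ adj-sym t₂u ∷ adj-sym (proj₂ (N-b₁ u) (here refl)) ∷
       adj-sym (proj₂ (N-b₂ u) (here refl)) ∷ []) ,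
    N-t₁ , ≐-trans N-t₂ (↭⇒≐ (↭-prep y (↭-prep u (↭-swap a₂ b₂ ↭-refl)))) , N-a₁ , N-b₁ , N-b₂ , N-a₂
    where
    open Sides △ {just hat} {just hat} σ₁ σ₂
    reorder : vertices ↭ x ∷ y ∷ u ∷ t₁ ∷ t₂ ∷ a₁ ∷ b₁ ∷ b₂ ∷ a₂ ∷ []
    reorder = ++⁺ˡ (x ∷ y ∷ u ∷ t₁ ∷ [])
      (↭-trans (shift t₂ (a₁ ∷ b₁ ∷ []) (a₂ ∷ b₂ ∷ [])) (↭-prep t₂ (↭-prep a₁ (↭-prep b₁ (↭-swap a₂ b₂ ↭-refl)))))
    u≢x = adj⇒≢ (adj-sym xu)
    u≢y = adj⇒≢ (adj-sym yu)
    prune : ∀ {z} → Adj G u z → z ∈ x ∷ y ∷ t₁ ∷ a₁ ∷ b₁ ∷ t₂ ∷ a₂ ∷ b₂ ∷ [] → z ∈ x ∷ y ∷ t₁ ∷ t₂ ∷ b₁ ∷ b₂ ∷ []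
    prune _ (here refl) = here refl
    prune _ (there (here refl)) = there (here refl)
    prune _ (there (there (here refl))) = there (there (here refl))
    prune ua₁ (there (there (there (here refl)))) =
      ⊥-elim (∉-neighbourhood N-a₁ u≢x (adj⇒≢ (adj-sym t₁u)) ua₁)
    prune _ (there (there (there (there (here refl))))) = there (there (there (there (here refl))))
    prune _ (there (there (there (there (there (here refl)))))) = there (there (there (here refl)))
    prune ua₂ (there (there (there (there (there (there (here refl))))))) =
      ⊥-elim (∉-neighbourhood N-a₂ u≢y (adj⇒≢ (adj-sym t₂u)) ua₂)
    prune _ (there (there (there (there (there (there (there (here refl)))))))) =
      there (there (there (there (there (here refl)))))

  sideCount : Maybe Kind → Maybe Kind → ℕ
  sideCount s₁ s₂ = total (count (present (s₁ ∷ s₂ ∷ [])))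

  branchSize : Maybe Kind → Maybe Kind → ℕ
  branchSize s₁ s₂ = 3 + sideSize s₁ + sideSize s₂

  -- a hat has 5 vertices and a double hat 9
  data Shape : Maybe Kind → Maybe Kind → Set where
    ear-shape : Shape nothing nothing
    hat-shape : Shape (just ear) (just ear)
    doubleHat-shape : Shape (just hat) (just hat)
    h2-shape : ∀ {s₁ s₂} → {True (1 ≤? sideCount s₁ s₂)} → {True (sideCount s₁ s₂ ≤? 2)} →
               {False (branchSize s₁ s₂ ℕ.≟ 5)} → {False (branchSize s₁ s₂ ℕ.≟ 9)} → Shape s₁ s₂

  shape : ∀ s₁ s₂ → Shape s₁ s₂
  shape nothing nothing = ear-shape
  shape nothing (just ear) = h2-shape
  shape nothing (just hat) = h2-shape
  shape nothing (just dhat) = h2-shape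
  shape (just ear) nothing = h2-shape
  shape (just ear) (just ear) = hat-shape
  shape (just ear) (just hat) = h2-shape
  shape (just ear) (just dhat) = h2-shape
  shape (just hat) nothing = h2-shape
  shape (just hat) (just ear) = h2-shape
  shape (just hat) (just hat) = doubleHat-shape
  shape (just hat) (just dhat) = h2-shape
  shape (just dhat) nothing = h2-shape
  shape (just dhat) (just ear) = h2-shape
  shape (just dhat) (just hat) = h2-shape
  shape (just dhat) (just dhat) = h2-shape

  Classification : Fin n → Fin n → Fin n → Set₁
  Classification x y u = (Σ Kind λ k → IsKind G k x y u) ⊎ Witness

  classify-by-sides : ∀ {x y u s₁ s₂} → Triangle G x y u → Side G x y u s₁ → Side G y x u s₂ → Shape s₁ s₂ →
                      Classification x y u
  classify-by-sides △ σ₁ σ₂ ear-shape = inj₁ (ear , ear-of-sides △ σ₁ σ₂)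
  classify-by-sides △ σ₁ σ₂ hat-shape = inj₁ (hat , hat-of-sides △ σ₁ σ₂)
  classify-by-sides △ σ₁ σ₂ doubleHat-shape = inj₁ (dhat , doubleHat-of-sides △ σ₁ σ₂)
  classify-by-sides {x} {y} {u} {s₁} {s₂} △ σ₁ σ₂ (h2-shape {_} {_} {count≥1} {count≤2} {≢5} {≢9}) =
    inj₂ (witness (BranchSet G x y u) (inj₁ inH2) vertices-unique branch≐vertices
                  (toWitnessFalse ≢5 ∘ trans (sym length-vertices)) (toWitnessFalse ≢9 ∘ trans (sym length-vertices)))
    where
    open Sides △ σ₁ σ₂
    counts = count (present (s₁ ∷ s₂ ∷ []))
    inH2 : InH2 G (BranchSet G x y u)
    inH2 = proj₁ counts , proj₁ (proj₂ counts) , proj₂ (proj₂ counts) , toWitness count≥1 , toWitness count≤2 ,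
           x , y , u , (△ , s₁ , s₂ , σ₁ , σ₂ , refl) , ≐-refl

  witness-of-two : ∀ {v₁ v₂ u₀ w₀} → Classification v₁ v₂ u₀ → Classification v₁ v₂ w₀ → u₀ ≢ w₀ → Witness
  witness-of-two (inj₂ W) _ _ = W
  witness-of-two (inj₁ _) (inj₂ W) _ = W
  witness-of-two (inj₁ (k₁ , κ₁)) (inj₁ (k₂ , κ₂)) u₀≢w₀ = twoBranches-witness k₁ k₂ κ₁ κ₂ u₀≢w₀

  adj? : ∀ i j → Dec (Adj G i j)
  adj? i j = G i j Bool.≟ true

  -- two branches at {v,u} give H: a member of T⁽²⁾, or one found inside either of them
  side : ∀ {v o u} → Triangle G v o u → (∀ {w} → Adj G u w → Adj G v w → w ≢ o → Classification v u w) →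
         Witness ⊎ Σ (Maybe Kind) (Side G v o u)
  side {v} {o} {u} (vo , ou , vu) classify-at with any? (λ w → adj? u w ×-dec adj? v w ×-dec ¬? (w ≟ o))
  ... | no none = inj₂ (nothing , only-o)
    where
    only-o : (N G u ∩ N G v) ≐ SetOf (o ∷ [])
    only-o z = (λ (uz , vz) → here (decidable-stable (z ≟ o) λ z≢o → none (z , uz , vz , z≢o))) ,
               λ { (here refl) → adj-sym ou , vo }
  ... | yes (w , uw , vw , w≢o)
    with any? (λ w′ → adj? u w′ ×-dec adj? v w′ ×-dec ¬? (w′ ≟ o) ×-dec ¬? (w′ ≟ w))
  ...   | yes (w′ , uw′ , vw′ , w′≢o , w′≢w) =
          inj₁ (witness-of-two (classify-at uw vw w≢o) (classify-at uw′ vw′ w′≢o) (w′≢w ∘ sym))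
  ...   | no none with classify-at uw vw w≢o
  ...     | inj₂ W = inj₁ W
  ...     | inj₁ (k , κ) = inj₂ (just k , w , w≢o , only-o-w , κ)
    where
    only-o-w : (N G u ∩ N G v) ≐ SetOf (o ∷ w ∷ [])
    only-o-w z = to , λ { (here refl) → adj-sym ou , vo ; (there (here refl)) → uw , vw }
      where
      to : Adj G u z × Adj G v z → z ∈ o ∷ w ∷ []
      to (uz , vz) with z ≟ o
      ... | yes z≡o = here z≡o
      ... | no z≢o = there (here (decidable-stable (z ≟ w) λ z≢w → none (z , uz , vz , z≢o , z≢w)))

  -- well-founded on the length of a list covering the component of u in G − {x,y}; the components of
  -- the sub-branches at {x,u} and {y,u} lie in it and miss u
  classify : (L : List (Fin n)) → Acc _<_ (length L) → ∀ {x y u} → Triangle G x y u →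
             (∀ {z} → Path G (pair x y) u z → z ∈ L) → Classification x y u
  classify L (acc smaller) {x} {y} {u} △ covers =
    combine (side △ (recurse △ (λ u⇝z → u⇝z))) (side (triangle-swap △) (recurse (triangle-swap △) path-pair-swap))
    where
    L′ : List (Fin n)
    L′ = filter (λ z → ¬? (z ≟ u)) L
    u∈L : u ∈ L
    u∈L = covers (here (∉-pair (adj⇒≢ (adj-sym (proj₂ (proj₂ △)))) (adj⇒≢ (adj-sym (proj₁ (proj₂ △))))))
    L′-shorter : length L′ < length L
    L′-shorter = filter-notAll _ L (Any.map (λ u≡z z≢u → z≢u (sym u≡z)) u∈L)
    recurse : ∀ {v o} → Triangle G v o u → (∀ {z} → Path G (pair v o) u z → Path G (pair x y) u z) →
              ∀ {w} → Adj G u w → Adj G v w → w ≢ o → Classification v u w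
    recurse △′@(_ , _ , vu) to-xy {w} uw vw w≢o = classify L′ (smaller L′-shorter) (vu , uw , vw) covers′
      where
      covers′ : ∀ {z} → Path G (pair _ u) w z → z ∈ L′
      covers′ w⇝z = ∈-filter⁺ _ (covers (to-xy (beyond⇒path △′ (w , vw , uw , w≢o , w⇝z)))) (path-target w⇝z ∘ there ∘ here)
    combine : Witness ⊎ Σ (Maybe Kind) (Side G x y u) → Witness ⊎ Σ (Maybe Kind) (Side G y x u) → Classification x y u
    combine (inj₁ W) _ = inj₂ W
    combine (inj₂ _) (inj₁ W) = inj₂ W
    combine (inj₂ (s₁ , σ₁)) (inj₂ (s₂ , σ₂)) = classify-by-sides △ σ₁ σ₂ (shape s₁ s₂)

  classify-triangle : ∀ {x y u} → Triangle G x y u → Classification x y u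
  classify-triangle △ = classify (allFin n) (<-wellFounded _) △ (λ _ → ∈-allFin _)

lemma3p1 : (n : ℕ) (G : Graph n) → TwoTree n G → 4 ≤ n →
    Σ (VSet n) λ H → (InH2 G H ⊎ InT2 G H) × ¬ IsHatOf G H × ¬ IsDoubleHatOf G H
lemma3p1 n G tree 4≤n =
  let (_ , _ , _ , _ , △u , △w , u≢w) = twoTree-diamond tree 4≤n
  in witness-of-two (classify-triangle △u) (classify-triangle △w) u≢w
  where open Branches (twoTreeLike tree)
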